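{- Let $m,n$ be integers with $m\ge2$ and $m$ dividing $n$, and let $f:\mathbb{Z}/n\mathbb{Z}\to\mathbb{Z}/m\mathbb{Z}$. The following conditions are equivalent: (1) $f$ is congruence preserving, i.e. for all $x,y\in\mathbb{Z}/n\mathbb{Z}$, $\pi_{n,m}(x-y)$ divides $f(x)-f(y)$ in $\mathbb{Z}/m\mathbb{Z}$; (2) there is a congruence preserving function $F:\mathbb{N}\to\mathbb{N}$ with $\pi_m\circ F=f\circ\pi_n$ on $\mathbb{N}$; (3) there is a congruence preserving function $F:\mathbb{N}\to\mathbb{Z}$ with $\pi_m\circ F=f\circ\pi_n$ on $\mathbb{N}$.
   Context: For $k\ge1$: $\pi_k:\mathbb{Z}\to\mathbb{Z}/k\mathbb{Z}$ is the canonical surjective homomorphism; $\iota_k:\mathbb{Z}/k\mathbb{Z}\to\mathbb{N}$ maps a class to its representative in $\{0,\dots,k-1\}$; $\pi_{n,m}=\pi_m\circ\iota_n:\mathbb{Z}/n\mathbb{Z}\to\mathbb{Z}/m\mathbb{Z}$. A function $F$ from $\mathbb{N}$ to $\mathbb{N}$ (or to $\mathbb{Z}$) is congruence preserving if for all $a,b\in\mathbb{N}$, $a-b$ divides $F(a)-F(b)$ in $\mathbb{Z}$. -}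

module Defs where

open import Data.Nat using (ℕ; _+_; _*_; _∸_; NonZero)
open import Data.Nat.DivMod using (_mod_)
open import Data.Fin using (Fin; toℕ)
open import Data.Integer as ℤ using (ℤ; +_)
open import Data.Integer.DivMod using (_%ℕ_)
open import Data.Integer.Divisibility as ℤD using ()
open import Data.Product using (Σ; ∃)
open import Relation.Binary.PropositionalEquality using (_≡_)

-- ℤ/kℤ is represented by Fin k (k ≥ 1); the class of a is a mod k.
ZMod : ℕ → Set
ZMod k = Fin k

ι : ∀ {k} → ZMod k → ℕ
ι = toℕ

πℕ : (k : ℕ) → .{{NonZero k}} → ℕ → ZMod k
πℕ k a = a mod k

πℤ : (k : ℕ) → .{{NonZero k}} → ℤ → ZMod k
πℤ k z = (z %ℕ k) mod k

π[_,_] : (n m : ℕ) → .{{NonZero m}} → ZMod n → ZMod m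
π[ n , m ] x = πℕ m (ι x)

sub : (k : ℕ) → .{{NonZero k}} → ZMod k → ZMod k → ZMod k
sub k x y = (ι x + (k ∸ ι y)) mod k

mul : (k : ℕ) → .{{NonZero k}} → ZMod k → ZMod k → ZMod k
mul k x y = (ι x * ι y) mod k

Divides : (k : ℕ) → .{{NonZero k}} → ZMod k → ZMod k → Set
Divides k a b = ∃ λ (c : ZMod k) → mul k c a ≡ b

CongPresMod : (n m : ℕ) → .{{NonZero n}} → .{{NonZero m}} → (ZMod n → ZMod m) → Set
CongPresMod n m f =
  ∀ (x y : ZMod n) → Divides m (π[ n , m ] (sub n x y)) (sub m (f x) (f y))

CongPresℕℕ : (ℕ → ℕ) → Set
CongPresℕℕ F = ∀ (a b : ℕ) → (+ a ℤ.- + b) ℤD.∣ (+ F a ℤ.- + F b)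

CongPresℕℤ : (ℕ → ℤ) → Set
CongPresℕℤ F = ∀ (a b : ℕ) → (+ a ℤ.- + b) ℤD.∣ (F a ℤ.- F b)

-- Write T a for the integer representative of f (π_n a).  Condition (1) says
-- T a − T b ≡ q·(a − b) (mod m) for some q, so T respects congruence modulo
-- every divisor of m.  The heart of the proof is a lifting lemma: such a T
-- agrees modulo m with a congruence preserving F : ℕ → ℕ.  F is built one
-- value at a time; F N must satisfy F N ≡ T N (mod m) and F N ≡ F b (mod N − b)
-- for all b < N.  These congruences are pairwise compatible (residues agree
-- modulo every common divisor of the moduli), so a Chinese remainder theorem
-- for arbitrary moduli solves them.
module Submission where

open import Defs

open import Data.Nat as ℕ using (ℕ; zero; suc; _≤_; _<_; _∸_; _<?_; NonZero)
import Data.Nat.Properties as ℕ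
open import Data.Nat.Divisibility
  using (_∣_; divides; ∣-trans; *-monoʳ-∣; *-pres-∣; *-cancelʳ-∣; _∣0; >⇒∤)
open import Data.Nat.GCD
  using (gcd; gcd-GCD; module Bézout; gcd[m,n]∣m; gcd[m,n]∣n; gcd-greatest;
         c*gcd[m,n]≡gcd[cm,cn]; gcd[m,n]≡0⇒m≡0)
open import Data.Nat.LCM using (lcm; gcd*lcm; lcm-least; lcm[0,n]≡0; m∣lcm[m,n]; n∣lcm[m,n])
open import Data.Integer as ℤ using (ℤ; +_; _+_; _-_; _*_; -_; 0ℤ; 1ℤ; _%ℕ_; _/ℕ_)
open import Data.Integer.DivMod using (a≡a%ℕn+[a/ℕn]*n)
open import Data.Nat.DivMod using (m%n<n)
open import Data.Fin.Properties using (toℕ-injective; toℕ<n; toℕ-fromℕ<)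
open import Data.List using (List; []; _∷_; foldr; applyDownFrom)
open import Data.List.Relation.Unary.All as All using (All; []; _∷_)
import Data.List.Relation.Unary.All.Properties as All
open import Data.List.Relation.Unary.AllPairs using (AllPairs; []; _∷_)
import Data.List.Relation.Unary.AllPairs.Properties as AllPairs
open import Function using (_∘_)
open import Function.Bundles using (_⇔_; mk⇔)
import Data.Integer.Properties as ℤ
import Data.Integer.Divisibility as ℤᵤ
open import Data.Integer.Divisibility.Signed as ℤ∣ using (divides; ∣ᵤ⇒∣; ∣⇒∣ᵤ) renaming (_∣_ to _∣ℤ_)
open import Data.Integer.Tactic.RingSolver using (solve-∀)
open import Relation.Binary.Bundles using (Setoid)
import Relation.Binary.Reasoning.Setoid as SetoidReasoning
open import Level using (0ℓ)
open import Relation.Binary.PropositionalEquality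
open import Relation.Nullary using (contradiction; yes; no)
open import Relation.Binary.Definitions using (tri<; tri≈; tri>)
open import Data.Sum using (inj₁; inj₂)
open import Data.Product using (Σ; _×_; _,_; proj₁; proj₂; ∃; ∃₂)

infix 4 _≡_[mod_]

-- Congruence of integers modulo a natural number: k divides a − b.  It is a
-- record so that a and b can be inferred from the type.
record _≡_[mod_] (a b : ℤ) (k : ℕ) : Set where
  constructor congruent
  field
    divides-difference : + k ∣ℤ a - b

module _ {k : ℕ} where

  mod-refl : ∀ {a} → a ≡ a [mod k ]
  mod-refl {a} = congruent (divides 0ℤ (trans (ℤ.+-inverseʳ a) (sym (ℤ.*-zeroˡ (+ k)))))

  mod-sym : ∀ {a b} → a ≡ b [mod k ] → b ≡ a [mod k ]
  mod-sym {a} {b} (congruent p) = congruent (subst (+ k ∣ℤ_) (negate-diff a b) (ℤ∣.∣m⇒∣-m p))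
    where
    negate-diff : ∀ a b → - (a - b) ≡ b - a
    negate-diff = solve-∀

  mod-trans : ∀ {a b c} → a ≡ b [mod k ] → b ≡ c [mod k ] → a ≡ c [mod k ]
  mod-trans {a} {b} {c} (congruent p) (congruent q) =
    congruent (subst (+ k ∣ℤ_) (telescope a b c) (ℤ∣.∣m∣n⇒∣m+n p q))
    where
    telescope : ∀ a b c → (a - b) + (b - c) ≡ a - c
    telescope = solve-∀

  mod-- : ∀ {a a′ b b′} → a ≡ a′ [mod k ] → b ≡ b′ [mod k ] → a - b ≡ a′ - b′ [mod k ]
  mod-- {a} {a′} {b} {b′} (congruent p) (congruent q) =
    congruent (subst (+ k ∣ℤ_) (regroup a a′ b b′) (ℤ∣.∣m∣n⇒∣m-n p q))
    where
    regroup : ∀ a a′ b b′ → (a - a′) - (b - b′) ≡ (a - b) - (a′ - b′)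
    regroup = solve-∀

  mod-* : ∀ {a a′ b b′} → a ≡ a′ [mod k ] → b ≡ b′ [mod k ] → a * b ≡ a′ * b′ [mod k ]
  mod-* {a} {a′} {b} {b′} (congruent p) (congruent q) = congruent
    (subst (+ k ∣ℤ_) (regroup a a′ b b′) (ℤ∣.∣m∣n⇒∣m+n (ℤ∣.∣m⇒∣m*n b p) (ℤ∣.∣n⇒∣m*n a′ q)))
    where
    regroup : ∀ a a′ b b′ → (a - a′) * b + a′ * (b - b′) ≡ a * b - a′ * b′
    regroup = solve-∀

  mod-*ˡ : ∀ c {b b′} → b ≡ b′ [mod k ] → c * b ≡ c * b′ [mod k ]
  mod-*ˡ c = mod-* (mod-refl {c})

  mod--ˡ : ∀ c {b b′} → b ≡ b′ [mod k ] → c - b ≡ c - b′ [mod k ]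
  mod--ˡ c = mod-- (mod-refl {c})

  mod-+multiple : ∀ a q → a + q * + k ≡ a [mod k ]
  mod-+multiple a q = congruent (divides q (cancel a (q * + k)))
    where
    cancel : ∀ a b → (a + b) - a ≡ b
    cancel = solve-∀

mod-∣ : ∀ {c k a b} → c ∣ k → a ≡ b [mod k ] → a ≡ b [mod c ]
mod-∣ c∣k (congruent p) = congruent (ℤ∣.∣-trans (∣ᵤ⇒∣ c∣k) p)

mod-1 : ∀ {a b} → a ≡ b [mod 1 ]
mod-1 {a} {b} = congruent (divides (a - b) (sym (ℤ.*-identityʳ (a - b))))

≡-mod-setoid : ℕ → Setoid 0ℓ 0ℓ
≡-mod-setoid k = record
  { Carrier       = ℤ
  ; _≈_           = _≡_[mod k ]
  ; isEquivalence = record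
    { refl  = λ {a} → mod-refl {k} {a}
    ; sym   = λ {a} {b} → mod-sym {k} {a} {b}
    ; trans = λ {a} {b} {c} → mod-trans {k} {a} {b} {c}
    }
  }

module ≡-mod-Reasoning (k : ℕ) = SetoidReasoning (≡-mod-setoid k)

%ℕ-mod : ∀ z k .{{_ : NonZero k}} → + (z %ℕ k) ≡ z [mod k ]
%ℕ-mod z k = mod-sym (subst (_≡ + (z %ℕ k) [mod k ]) (sym (a≡a%ℕn+[a/ℕn]*n z k))
                            (mod-+multiple (+ (z %ℕ k)) (z /ℕ k)))

-- The lcm distributes over the gcd, in the form needed by the Chinese
-- remainder theorem: with u = gcd c d, v = gcd c e and w = gcd u v, a divisor
-- c of lcm d e satisfies c·w ∣ u·v = lcm u v · w, so c ∣ lcm u v.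
∣lcm⇒∣lcm-gcd : ∀ {c d e} → c ∣ lcm d e → c ∣ lcm (gcd c d) (gcd c e)
∣lcm⇒∣lcm-gcd {c} {d} {e} c∣lcm = cancel (gcd u v) refl c*w∣lcm*w
  where
  u v w : ℕ
  u = gcd c d
  v = gcd c e
  w = gcd u v

  w∣v : w ∣ v
  w∣v = gcd[m,n]∣n u v

  w∣d : w ∣ d
  w∣d = ∣-trans (gcd[m,n]∣m u v) (gcd[m,n]∣n c d)

  w∣e : w ∣ e
  w∣e = ∣-trans w∣v (gcd[m,n]∣n c e)

  -- c·w divides d·c and d·e (as c ∣ lcm d e and w ∣ gcd d e), hence
  -- d·v = gcd (d·c) (d·e); it divides c·v too, hence u·v = gcd (v·c) (v·d)
  c*w∣d*e : c ℕ.* w ∣ d ℕ.* e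
  c*w∣d*e = subst (c ℕ.* w ∣_) (trans (ℕ.*-comm (lcm d e) (gcd d e)) (gcd*lcm d e))
                  (*-pres-∣ c∣lcm (gcd-greatest w∣d w∣e))

  c*w∣d*c : c ℕ.* w ∣ d ℕ.* c
  c*w∣d*c = subst (c ℕ.* w ∣_) (ℕ.*-comm c d) (*-monoʳ-∣ c w∣d)

  c*w∣d*v : c ℕ.* w ∣ v ℕ.* d
  c*w∣d*v = subst (c ℕ.* w ∣_) (trans (sym (c*gcd[m,n]≡gcd[cm,cn] d c e)) (ℕ.*-comm d v))
                  (gcd-greatest c*w∣d*c c*w∣d*e)

  c*w∣c*v : c ℕ.* w ∣ v ℕ.* c
  c*w∣c*v = subst (c ℕ.* w ∣_) (ℕ.*-comm c v) (*-monoʳ-∣ c w∣v)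

  c*w∣lcm*w : c ℕ.* w ∣ lcm u v ℕ.* w
  c*w∣lcm*w = subst (c ℕ.* w ∣_) u*v≡lcm*w (gcd-greatest c*w∣c*v c*w∣d*v)
    where
    u*v≡lcm*w : gcd (v ℕ.* c) (v ℕ.* d) ≡ lcm u v ℕ.* w
    u*v≡lcm*w = begin
      gcd (v ℕ.* c) (v ℕ.* d)  ≡⟨ c*gcd[m,n]≡gcd[cm,cn] v c d ⟨
      v ℕ.* u                  ≡⟨ ℕ.*-comm v u ⟩
      u ℕ.* v                  ≡⟨ gcd*lcm u v ⟨
      w ℕ.* lcm u v            ≡⟨ ℕ.*-comm w (lcm u v) ⟩
      lcm u v ℕ.* w            ∎
      where open ≡-Reasoning

  -- w = 0 forces u = 0 and lcm 0 v = 0; otherwise cancel w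
  cancel : ∀ w′ → w ≡ w′ → c ℕ.* w′ ∣ lcm u v ℕ.* w′ → c ∣ lcm u v
  cancel zero    w≡0 _ = subst (λ x → c ∣ lcm x v) (sym (gcd[m,n]≡0⇒m≡0 {u} {v} w≡0))
                         (subst (c ∣_) (sym (lcm[0,n]≡0 v)) (c ∣0))
  cancel (suc k) _   p = *-cancelʳ-∣ (suc k) p

mod-lcm-gcd : ∀ {c d e a b} → c ∣ lcm d e →
              a ≡ b [mod gcd c d ] → a ≡ b [mod gcd c e ] → a ≡ b [mod c ]
mod-lcm-gcd c∣lcm (congruent p) (congruent q) =
  congruent (∣ᵤ⇒∣ (∣-trans (∣lcm⇒∣lcm-gcd c∣lcm) (lcm-least (∣⇒∣ᵤ p) (∣⇒∣ᵤ q))))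

-- the lcm of nonzero numbers is nonzero, since gcd m n · lcm m n = m · n
lcm-nonZero : ∀ m n → .{{NonZero m}} → .{{NonZero n}} → NonZero (lcm m n)
lcm-nonZero m n = ℕ.m*n≢0⇒n≢0 (gcd m n) {{subst NonZero (sym (gcd*lcm m n)) (ℕ.m*n≢0 m n)}}

+-as-difference : ∀ {g a b} → g ℕ.+ a ≡ b → + g ≡ + b - + a
+-as-difference {g} {a} refl = sym (trans (cong (_- + a) (ℤ.pos-+ g a)) (cancel (+ g) (+ a)))
  where
  cancel : ∀ x y → (x + y) - y ≡ x
  cancel = solve-∀

bezout : ∀ m n → ∃₂ λ α β → + gcd m n ≡ α * + m + β * + n
bezout m n with Bézout.identity (gcd-GCD m n)
... | Bézout.+- x y eq = + x , - + y , (begin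
  + gcd m n                     ≡⟨ +-as-difference eq ⟩
  + (x ℕ.* m) - + (y ℕ.* n)     ≡⟨ cong₂ _-_ (ℤ.pos-* x m) (ℤ.pos-* y n) ⟩
  + x * + m - + y * + n         ≡⟨ cong (_+_ (+ x * + m)) (ℤ.neg-distribˡ-* (+ y) (+ n)) ⟩
  + x * + m + - + y * + n       ∎)
  where open ≡-Reasoning
... | Bézout.-+ x y eq = - + x , + y , (begin
  + gcd m n                     ≡⟨ +-as-difference eq ⟩
  + (y ℕ.* n) - + (x ℕ.* m)     ≡⟨ cong₂ _-_ (ℤ.pos-* y n) (ℤ.pos-* x m) ⟩
  + y * + n - + x * + m         ≡⟨ swap (+ x) (+ m) (+ y * + n) ⟩
  - + x * + m + + y * + n       ∎)
  where
  open ≡-Reasoning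
  swap : ∀ a b c → c - a * b ≡ - a * b + c
  swap = solve-∀

-- Two congruences are simultaneously solvable when their residues agree
-- modulo the gcd of the moduli: if s − x = q·gcd m n = q·(α·m + β·n), then
-- y = x + α·q·m satisfies y ≡ x (mod m) and y ≡ s (mod n).
crt₂ : ∀ {x s m n} → s ≡ x [mod gcd m n ] → ∃ λ y → y ≡ x [mod m ] × y ≡ s [mod n ]
crt₂ {x} {s} {m} {n} (congruent (divides q s-x≡q*g)) with bezout m n
... | α , β , g≡αm+βn =
  x + α * q * + m , mod-+multiple x (α * q) , congruent (divides (- (β * q)) (begin
  (x + α * q * + m) - s                   ≡⟨ rearrange x s (α * q * + m) ⟩
  α * q * + m - (s - x)                   ≡⟨ cong (λ d → α * q * + m - d) s-x≡q*g ⟩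
  α * q * + m - q * + gcd m n             ≡⟨ cong (λ g → α * q * + m - q * g) g≡αm+βn ⟩
  α * q * + m - q * (α * + m + β * + n)   ≡⟨ collect α β q (+ m) (+ n) ⟩
  - (β * q) * + n                         ∎))
  where
  open ≡-Reasoning
  rearrange : ∀ x s t → (x + t) - s ≡ t - (s - x)
  rearrange = solve-∀
  collect : ∀ α β q m n → α * q * m - q * (α * m + β * n) ≡ - (β * q) * n
  collect = solve-∀

Congruence : Set
Congruence = ℤ × ℕ

_satisfies_ : ℤ → Congruence → Set
x satisfies (r , d) = x ≡ r [mod d ]

Compatible : Congruence → Congruence → Set
Compatible (r , d) (s , e) = ∀ {c} → c ∣ d → c ∣ e → r ≡ s [mod c ]

modulus : List Congruence → ℕ
modulus = foldr (λ p M → lcm (proj₂ p) M) 1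

modulus-nonZero : ∀ cs → All (NonZero ∘ proj₂) cs → NonZero (modulus cs)
modulus-nonZero []             []       = _
modulus-nonZero ((r , d) ∷ cs) (d≢0 ∷ ds) =
  lcm-nonZero d (modulus cs) {{d≢0}} {{modulus-nonZero cs ds}}

satisfies-mod : ∀ {x y} cs → y ≡ x [mod modulus cs ] → All (x satisfies_) cs → All (y satisfies_) cs
satisfies-mod []             y≡x []           = []
satisfies-mod ((r , d) ∷ cs) y≡x (x≡r ∷ sats) =
  mod-trans (mod-∣ (m∣lcm[m,n] d (modulus cs)) y≡x) x≡r
  ∷ satisfies-mod cs (mod-∣ (n∣lcm[m,n] d (modulus cs)) y≡x) sats

-- A congruence (s , e) compatible with every member of a system agrees with
-- any solution x of the system modulo each common divisor of e and the
-- system's modulus; this is where lcm/gcd distributivity enters.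
compatible-with-solution : ∀ {s e x} cs → All (Compatible (s , e)) cs → All (x satisfies_) cs →
                           ∀ {c} → c ∣ e → c ∣ modulus cs → s ≡ x [mod c ]
compatible-with-solution []             []            []            c∣e c∣1 =
  mod-∣ c∣1 mod-1
compatible-with-solution ((r , d) ∷ cs) (comp ∷ comps) (x≡r ∷ sats) {c} c∣e c∣lcm =
  mod-lcm-gcd c∣lcm
    (mod-trans (comp (∣-trans (gcd[m,n]∣m c d) c∣e) (gcd[m,n]∣n c d))
               (mod-sym (mod-∣ (gcd[m,n]∣n c d) x≡r)))
    (compatible-with-solution cs comps sats (∣-trans (gcd[m,n]∣m c _) c∣e) (gcd[m,n]∣n c _))

crt : ∀ cs → AllPairs Compatible cs → ∃ λ x → All (x satisfies_) cs
crt []             []              = 0ℤ , []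
crt ((s , e) ∷ cs) (comps ∷ pairs) = add (crt cs pairs)
  where
  add : ∃ (λ x → All (x satisfies_) cs) → ∃ λ y → All (y satisfies_) ((s , e) ∷ cs)
  add (x , sats) =
    let s≡x = compatible-with-solution cs comps sats
                (gcd[m,n]∣n (modulus cs) e) (gcd[m,n]∣m (modulus cs) e)
        (y , y≡x , y≡s) = crt₂ {x} {s} {modulus cs} {e} s≡x
    in y , y≡s ∷ satisfies-mod cs y≡x sats

crtℕ : ∀ cs → All (NonZero ∘ proj₂) cs → AllPairs Compatible cs →
       ∃ λ (v : ℕ) → All ((+ v) satisfies_) cs
crtℕ cs nonZero pairs =
  let (x , sats) = crt cs pairs
      instance M≢0 = modulus-nonZero cs nonZero
  in x %ℕ modulus cs , satisfies-mod cs (%ℕ-mod x (modulus cs)) sats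

+-∸ : ∀ {a b} → b ≤ a → + a - + b ≡ + (a ∸ b)
+-∸ {a} {b} b≤a = trans (ℤ.[+m]-[+n]≡m⊖n a b) (ℤ.⊖-≥ b≤a)

∣∸⇒mod : ∀ {a b c} → b ≤ a → c ∣ a ∸ b → + a ≡ + b [mod c ]
∣∸⇒mod {c = c} b≤a c∣a∸b = congruent (subst (+ c ∣ℤ_) (sym (+-∸ b≤a)) (∣ᵤ⇒∣ c∣a∸b))

mod⇒∣∸ : ∀ {a b c} → b ≤ a → + a ≡ + b [mod c ] → c ∣ a ∸ b
mod⇒∣∸ {c = c} b≤a (congruent p) = ∣⇒∣ᵤ (subst (+ c ∣ℤ_) (+-∸ b≤a) p)

mod⇒∣ᵤ : ∀ {a b x y} → b ≤ a → x ≡ y [mod a ∸ b ] → (+ a - + b) ℤᵤ.∣ (x - y)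
mod⇒∣ᵤ {x = x} {y} b≤a (congruent p) = ∣⇒∣ᵤ (subst (_∣ℤ x - y) (sym (+-∸ b≤a)) p)

∣ᵤ-swap : ∀ {i j x y} → (i - j) ℤᵤ.∣ (x - y) → (j - i) ℤᵤ.∣ (y - x)
∣ᵤ-swap {i} {j} {x} {y} = subst₂ _∣_ (ℤ.∣i-j∣≡∣j-i∣ i j) (ℤ.∣i-j∣≡∣j-i∣ x y)

congPres-from-below : (G : ℕ → ℤ) → (∀ {a b} → b < a → G a ≡ G b [mod a ∸ b ]) → CongPresℕℤ G
congPres-from-below G below a b with ℕ.<-cmp a b
... | tri< a<b _ _  = ∣ᵤ-swap {+ b} {+ a} {G b} {G a} (mod⇒∣ᵤ (ℕ.<⇒≤ a<b) (below a<b))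
... | tri≈ _ refl _ = mod⇒∣ᵤ {a} {a} ℕ.≤-refl (mod-∣ ((a ∸ a) ∣0) (mod-refl {0} {G a}))
... | tri> _ _ b<a  = mod⇒∣ᵤ (ℕ.<⇒≤ b<a) (below b<a)

applyDownFrom⁻ : ∀ {A : Set} {P : A → Set} f n → All P (applyDownFrom f n) → ∀ {i} → i < n → P (f i)
applyDownFrom⁻ f (suc n) (p ∷ ps) {i} i<1+n with ℕ.m<1+n⇒m<n∨m≡n i<1+n
... | inj₁ i<n  = applyDownFrom⁻ f n ps i<n
... | inj₂ refl = p

extendAt : ℕ → (ℕ → ℕ) → ℕ → ℕ → ℕ
extendAt N g v b with b <? N
... | yes _ = g b
... | no  _ = v

extendAt-below : ∀ {N b} g v → b < N → extendAt N g v b ≡ g b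
extendAt-below {N} {b} g v b<N with b <? N
... | yes _    = refl
... | no  b≮N = contradiction b<N b≮N

extendAt-at : ∀ N g v → extendAt N g v N ≡ v
extendAt-at N g v with N <? N
... | yes N<N = contradiction N<N (ℕ.<-irrefl refl)
... | no  _   = refl

extendAt-all : ∀ {N} (P : ℕ → ℕ → Set) g v → (∀ {a} → a < N → P a (g a)) → P N v →
               ∀ {a} → a < suc N → P a (extendAt N g v a)
extendAt-all P g v below at {a} a<1+N with ℕ.m<1+n⇒m<n∨m≡n a<1+N
... | inj₁ a<N  = subst (P a) (sym (extendAt-below g v a<N)) (below a<N)
... | inj₂ refl = subst (P a) (sym (extendAt-at a g v)) at

-- F is built value by value: F N solves the system F N ≡ T N (mod m),
-- F N ≡ F b (mod N − b) for b < N, which is compatible by the hypothesis on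
-- T and congruence preservation of F below N.
module Lift (m : ℕ) .{{_ : NonZero m}} (T : ℕ → ℤ)
            (T-respects : ∀ {a b c} → c ∣ m → + a ≡ + b [mod c ] → T a ≡ T b [mod c ])
            where

  record Stage (N : ℕ) : Set where
    field
      value     : ℕ → ℕ
      lifts     : ∀ {a} → a < N → + value a ≡ T a [mod m ]
      preserves : ∀ {a b} → b < a → a < N → + value a ≡ + value b [mod a ∸ b ]

  -- the congruences a value at N extending g must satisfy
  system : ℕ → (ℕ → ℕ) → List Congruence
  system N g = (T N , m) ∷ applyDownFrom (λ b → + g b , N ∸ b) N

  system-nonZero : ∀ N g → All (NonZero ∘ proj₂) (system N g)
  -- (the first proof recovers a relevant NonZero m from the irrelevant instance)
  system-nonZero N g = ℕ.>-nonZero (ℕ.>-nonZero⁻¹ m)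
                     ∷ All.applyDownFrom⁺₁ _ N (λ b<N → ℕ.>-nonZero (ℕ.m<n⇒0<n∸m b<N))

  system-compatible : ∀ {N} (s : Stage N) → AllPairs Compatible (system N (Stage.value s))
  system-compatible {N} s = All.applyDownFrom⁺₁ _ N T-compatible
                          ∷ AllPairs.applyDownFrom⁺₁ _ N value-compatible
    where
    open Stage s

    T-compatible : ∀ {b} → b < N → Compatible (T N , m) (+ value b , N ∸ b)
    T-compatible b<N c∣m c∣N∸b =
      mod-trans (T-respects c∣m (∣∸⇒mod (ℕ.<⇒≤ b<N) c∣N∸b)) (mod-∣ c∣m (mod-sym (lifts b<N)))

    value-compatible : ∀ {i j} → j < i → i < N → Compatible (+ value i , N ∸ i) (+ value j , N ∸ j)
    value-compatible {i} {j} j<i i<N {c} c∣N∸i c∣N∸j = mod-∣ c∣i∸j (preserves j<i i<N)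
      where
      c∣i∸j : c ∣ i ∸ j
      c∣i∸j = mod⇒∣∸ (ℕ.<⇒≤ j<i) (mod-trans (mod-sym (∣∸⇒mod (ℕ.<⇒≤ i<N) c∣N∸i))
                                             (∣∸⇒mod (ℕ.<⇒≤ (ℕ.<-trans j<i i<N)) c∣N∸j))

  next : ∀ {N} (s : Stage N) → ∃ λ v → All ((+ v) satisfies_) (system N (Stage.value s))
  next {N} s = crtℕ (system N value) (system-nonZero N value) (system-compatible s)
    where open Stage s

  next-lifts : ∀ {N} (s : Stage N) → + proj₁ (next s) ≡ T N [mod m ]
  next-lifts s = All.head (proj₂ (next s))

  next-preserves : ∀ {N} (s : Stage N) {b} → b < N →
                   + proj₁ (next s) ≡ + Stage.value s b [mod N ∸ b ]
  next-preserves {N} s = applyDownFrom⁻ _ N (All.tail (proj₂ (next s)))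

  extend : ∀ {N} → Stage N → Stage (suc N)
  extend {N} s = record
    { value     = extendAt N value v
    ; lifts     = extendAt-all (λ a x → + x ≡ T a [mod m ]) value v lifts (next-lifts s)
    ; preserves = λ {a} {b} b<a a<1+N →
        subst (λ y → + extendAt N value v a ≡ + y [mod a ∸ b ])
              (sym (extendAt-below value v (ℕ.<-≤-trans b<a (ℕ.s≤s⁻¹ a<1+N))))
              (extendAt-all (λ a x → b < a → + x ≡ + value b [mod a ∸ b ]) value v
                            (λ a<N b<a → preserves b<a a<N) (next-preserves s) a<1+N b<a)
    }
    where
    open Stage s
    v : ℕ
    v = proj₁ (next s)

  stage : ∀ N → Stage N
  stage zero    = record { value = λ _ → 0 ; lifts = λ () ; preserves = λ _ () }
  stage (suc N) = extend (stage N)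

  F : ℕ → ℕ
  F N = proj₁ (next (stage N))

  stage-value : ∀ N {a} → a < N → Stage.value (stage N) a ≡ F a
  stage-value (suc N) = extendAt-all (λ a x → x ≡ F a) _ (F N) (stage-value N) refl

  F-lifts : ∀ a → + F a ≡ T a [mod m ]
  F-lifts a = next-lifts (stage a)

  F-preserves : ∀ {a b} → b < a → + F a ≡ + F b [mod a ∸ b ]
  F-preserves {a} {b} b<a =
    subst (λ x → + F a ≡ + x [mod a ∸ b ]) (stage-value a b<a) (next-preserves (stage a) b<a)

-- CongPresℕℕ F is by definition CongPresℕℤ of λ x → + F x
lift : (m : ℕ) .{{_ : NonZero m}} (T : ℕ → ℤ) →
       (∀ {a b c} → c ∣ m → + a ≡ + b [mod c ] → T a ≡ T b [mod c ]) →
       Σ (ℕ → ℕ) λ F → CongPresℕℕ F × (∀ x → + F x ≡ T x [mod m ])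
lift m T T-respects = F , congPres-from-below (λ x → + F x) F-preserves , F-lifts
  where open Lift m T T-respects

⟦_⟧ : ∀ {k} → ZMod k → ℤ
⟦ u ⟧ = + ι u

∣∧<⇒≡0 : ∀ {k d} → k ∣ d → d < k → d ≡ 0
∣∧<⇒≡0 {d = zero}  _   _   = refl
∣∧<⇒≡0 {d = suc d} k∣d d<k = contradiction k∣d (>⇒∤ d<k)

congruent-below-≤ : ∀ {k a b} → b ≤ a → a < k → + a ≡ + b [mod k ] → a ≡ b
congruent-below-≤ {a = a} {b} b≤a a<k a≡b =
  ℕ.≤-antisym (ℕ.m∸n≡0⇒m≤n (∣∧<⇒≡0 (mod⇒∣∸ b≤a a≡b) (ℕ.≤-<-trans (ℕ.m∸n≤m a b) a<k))) b≤a

congruent-below : ∀ {k a b} → a < k → b < k → + a ≡ + b [mod k ] → a ≡ b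
congruent-below {a = a} {b} a<k b<k a≡b with ℕ.≤-total b a
... | inj₁ b≤a = congruent-below-≤ b≤a a<k a≡b
... | inj₂ a≤b = sym (congruent-below-≤ a≤b b<k (mod-sym a≡b))

residue-injective : ∀ {k} {u v : ZMod k} → ⟦ u ⟧ ≡ ⟦ v ⟧ [mod k ] → u ≡ v
residue-injective {u = u} {v} u≡v = toℕ-injective (congruent-below (toℕ<n u) (toℕ<n v) u≡v)

⟦πℕ⟧ : ∀ k .{{_ : NonZero k}} a → ⟦ πℕ k a ⟧ ≡ + a [mod k ]
⟦πℕ⟧ k a = subst (_≡ + a [mod k ]) (cong +_ (sym (toℕ-fromℕ< (m%n<n a k)))) (%ℕ-mod (+ a) k)

⟦πℤ⟧ : ∀ k .{{_ : NonZero k}} z → ⟦ πℤ k z ⟧ ≡ z [mod k ]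
⟦πℤ⟧ k z = mod-trans (⟦πℕ⟧ k (z %ℕ k)) (%ℕ-mod z k)

πℕ-ι : ∀ k .{{_ : NonZero k}} (u : ZMod k) → πℕ k (ι u) ≡ u
πℕ-ι k u = residue-injective (⟦πℕ⟧ k (ι u))

⟦sub⟧ : ∀ k .{{_ : NonZero k}} (u v : ZMod k) → ⟦ sub k u v ⟧ ≡ ⟦ u ⟧ - ⟦ v ⟧ [mod k ]
⟦sub⟧ k u v = begin
  ⟦ sub k u v ⟧                   ≈⟨ ⟦πℕ⟧ k (ι u ℕ.+ (k ∸ ι v)) ⟩
  + (ι u ℕ.+ (k ∸ ι v))           ≡⟨ ℤ.pos-+ (ι u) (k ∸ ι v) ⟩
  ⟦ u ⟧ + + (k ∸ ι v)             ≡⟨ cong (_+_ ⟦ u ⟧) (+-∸ (ℕ.<⇒≤ (toℕ<n v))) ⟨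
  ⟦ u ⟧ + (+ k - ⟦ v ⟧)           ≡⟨ regroup ⟦ u ⟧ ⟦ v ⟧ (+ k) ⟩
  (⟦ u ⟧ - ⟦ v ⟧) + 1ℤ * + k      ≈⟨ mod-+multiple (⟦ u ⟧ - ⟦ v ⟧) 1ℤ ⟩
  ⟦ u ⟧ - ⟦ v ⟧                   ∎
  where
  open ≡-mod-Reasoning k
  regroup : ∀ x y k → x + (k - y) ≡ (x - y) + 1ℤ * k
  regroup = solve-∀

⟦mul⟧ : ∀ k .{{_ : NonZero k}} (u v : ZMod k) → ⟦ mul k u v ⟧ ≡ ⟦ u ⟧ * ⟦ v ⟧ [mod k ]
⟦mul⟧ k u v = subst (⟦ mul k u v ⟧ ≡_[mod k ]) (ℤ.pos-* (ι u) (ι v)) (⟦πℕ⟧ k (ι u ℕ.* ι v))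

module Conditions (m n : ℕ) .{{_ : NonZero m}} .{{_ : NonZero n}} (m∣n : m ∣ n)
                  (f : ZMod n → ZMod m) where

  T : ℕ → ℤ
  T a = ⟦ f (πℕ n a) ⟧

  ⟦π-sub⟧ : ∀ (x y : ZMod n) → ⟦ π[ n , m ] (sub n x y) ⟧ ≡ ⟦ x ⟧ - ⟦ y ⟧ [mod m ]
  ⟦π-sub⟧ x y = mod-trans (⟦πℕ⟧ m (ι (sub n x y))) (mod-∣ m∣n (⟦sub⟧ n x y))

  cp⇒linear : CongPresMod n m f → ∀ a b → ∃ λ q → T a - T b ≡ q * (+ a - + b) [mod m ]
  cp⇒linear cp a b = ⟦ c ⟧ , (begin
    ⟦ f x ⟧ - ⟦ f y ⟧          ≈⟨ mod-sym (⟦sub⟧ m (f x) (f y)) ⟩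
    ⟦ sub m (f x) (f y) ⟧      ≡⟨ cong ⟦_⟧ c*p≡fx-fy ⟨
    ⟦ mul m c p ⟧              ≈⟨ ⟦mul⟧ m c p ⟩
    ⟦ c ⟧ * ⟦ p ⟧              ≈⟨ mod-*ˡ ⟦ c ⟧ (⟦π-sub⟧ x y) ⟩
    ⟦ c ⟧ * (⟦ x ⟧ - ⟦ y ⟧)    ≈⟨ mod-*ˡ ⟦ c ⟧ (mod-∣ m∣n (mod-- (⟦πℕ⟧ n a) (⟦πℕ⟧ n b))) ⟩
    ⟦ c ⟧ * (+ a - + b)        ∎)
    where
    open ≡-mod-Reasoning m
    x y : ZMod n
    x = πℕ n a
    y = πℕ n b
    p : ZMod m
    p = π[ n , m ] (sub n x y)
    c : ZMod m
    c = proj₁ (cp x y)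
    c*p≡fx-fy : mul m c p ≡ sub m (f x) (f y)
    c*p≡fx-fy = proj₂ (cp x y)

  linear⇒respects : (∀ a b → ∃ λ q → T a - T b ≡ q * (+ a - + b) [mod m ]) →
                    ∀ {a b c} → c ∣ m → + a ≡ + b [mod c ] → T a ≡ T b [mod c ]
  linear⇒respects linear {a} {b} {c} c∣m a≡b = mod-sym (begin
    T b                        ≡⟨ regroup (T a) (T b) ⟩
    T a - (T a - T b)          ≈⟨ mod--ˡ (T a) (mod-∣ c∣m (proj₂ (linear a b))) ⟩
    T a - q * (+ a - + b)      ≈⟨ mod--ˡ (T a) (mod-*ˡ q (mod-- a≡b (mod-refl {a = + b}))) ⟩
    T a - q * (+ b - + b)      ≡⟨ cong (λ d → T a - q * d) (ℤ.+-inverseʳ (+ b)) ⟩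
    T a - q * 0ℤ               ≡⟨ cong (_-_ (T a)) (ℤ.*-zeroʳ q) ⟩
    T a - 0ℤ                   ≡⟨ ℤ.+-identityʳ (T a) ⟩
    T a                        ∎)
    where
    open ≡-mod-Reasoning c
    q : ℤ
    q = proj₁ (linear a b)
    regroup : ∀ u v → v ≡ u - (u - v)
    regroup = solve-∀

  -- (1) ⇒ (2): lift T; F ≡ T (mod m) means π_m ∘ F = f ∘ π_n
  one⇒two : CongPresMod n m f → Σ (ℕ → ℕ) (λ F → CongPresℕℕ F × (∀ x → πℕ m (F x) ≡ f (πℕ n x)))
  one⇒two cp =
    let (F , F-cp , F≡T) = lift m T (linear⇒respects (cp⇒linear cp))
    in F , F-cp , λ x → residue-injective (mod-trans (⟦πℕ⟧ m (F x)) (F≡T x))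

  two⇒three : Σ (ℕ → ℕ) (λ F → CongPresℕℕ F × (∀ x → πℕ m (F x) ≡ f (πℕ n x)))
            → Σ (ℕ → ℤ) (λ F → CongPresℕℤ F × (∀ x → πℤ m (F x) ≡ f (πℕ n x)))
  two⇒three (F , F-cp , F-lifts) = (λ x → + F x) , F-cp , λ x →
    trans (residue-injective (mod-trans (⟦πℤ⟧ m (+ F x)) (mod-sym (⟦πℕ⟧ m (F x))))) (F-lifts x)

  -- (3) ⇒ (1): if F (ι x) − F (ι y) = q·(ι x − ι y), then π_m q is the
  -- multiplier required in (1), because F ∘ ι agrees with f modulo m
  three⇒one : Σ (ℕ → ℤ) (λ F → CongPresℕℤ F × (∀ x → πℤ m (F x) ≡ f (πℕ n x))) → CongPresMod n m f
  three⇒one (F , F-cp , F-lifts) x y = πℤ m q , residue-injective (begin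
    ⟦ mul m (πℤ m q) p ⟧       ≈⟨ ⟦mul⟧ m (πℤ m q) p ⟩
    ⟦ πℤ m q ⟧ * ⟦ p ⟧         ≈⟨ mod-* (⟦πℤ⟧ m q) (⟦π-sub⟧ x y) ⟩
    q * (⟦ x ⟧ - ⟦ y ⟧)        ≡⟨ Fx-Fy≡q*[x-y] ⟨
    F (ι x) - F (ι y)          ≈⟨ mod-- (F≡f x) (F≡f y) ⟩
    ⟦ f x ⟧ - ⟦ f y ⟧          ≈⟨ mod-sym (⟦sub⟧ m (f x) (f y)) ⟩
    ⟦ sub m (f x) (f y) ⟧      ∎)
    where
    open ≡-mod-Reasoning m
    p : ZMod m
    p = π[ n , m ] (sub n x y)
    x-y∣Fx-Fy : ⟦ x ⟧ - ⟦ y ⟧ ∣ℤ F (ι x) - F (ι y)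
    x-y∣Fx-Fy = ∣ᵤ⇒∣ {⟦ x ⟧ - ⟦ y ⟧} {F (ι x) - F (ι y)} (F-cp (ι x) (ι y))
    q : ℤ
    q = ℤ∣.quotient x-y∣Fx-Fy
    Fx-Fy≡q*[x-y] : F (ι x) - F (ι y) ≡ q * (⟦ x ⟧ - ⟦ y ⟧)
    Fx-Fy≡q*[x-y] = ℤ∣._∣_.equality x-y∣Fx-Fy
    F≡f : ∀ z → F (ι z) ≡ ⟦ f z ⟧ [mod m ]
    F≡f z = begin
      F (ι z)                  ≈⟨ mod-sym (⟦πℤ⟧ m (F (ι z))) ⟩
      ⟦ πℤ m (F (ι z)) ⟧       ≡⟨ cong ⟦_⟧ (trans (F-lifts (ι z)) (cong f (πℕ-ι n z))) ⟩
      ⟦ f z ⟧                  ∎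

theorem7 : (m n : ℕ) → .{{_ : NonZero m}} → .{{_ : NonZero n}} → 2 ≤ m → m ∣ n →
           (f : ZMod n → ZMod m) →
           (CongPresMod n m f ⇔ Σ (ℕ → ℕ) (λ F → CongPresℕℕ F × (∀ x → πℕ m (F x) ≡ f (πℕ n x))))
           × (CongPresMod n m f ⇔ Σ (ℕ → ℤ) (λ F → CongPresℕℤ F × (∀ x → πℤ m (F x) ≡ f (πℕ n x))))
theorem7 m n _ m∣n f =
    mk⇔ one⇒two (three⇒one ∘ two⇒three)
  , mk⇔ (two⇒three ∘ one⇒two) three⇒one
  where open Conditions m n m∣n f
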